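{- $\mathsf{WOP}(X\mapsto X^\omega) \not\le_{\mathrm W} (\mathsf{LPO}')^*$.
   Context: A problem is a partial multi-valued function from instances to sets of solutions. $\mathsf P\le_{\mathrm W}\mathsf Q$ means there are Turing functionals $H,K$ such that for every $\mathsf P$-instance $X$, $H(X)$ is a $\mathsf Q$-instance, and for every $\mathsf Q$-solution $\hat Y$ to $H(X)$, $K(X\oplus\hat Y)$ is a $\mathsf P$-solution to $X$. The finite parallelization $\mathsf P^*$ has instances $\langle n,X_1,\dots,X_n\rangle$ with each $X_i$ a $\mathsf P$-instance, and solutions tuples $\langle Y_1,\dots,Y_n\rangle$ with $Y_i$ a $\mathsf P$-solution to $X_i$. $\mathsf{LPO}:2^{\mathbb N}\to\{0,1\}$ outputs $0$ on $p$ iff $p=0^{\mathbb N}$. $\mathsf{LPO}'$ takes as input (a code for) a sequence $\langle p_0,p_1,\dots\rangle$ of infinite binary sequences such that $p(i)=\lim_{s\to\infty}p_i(s)$ exists for every $i$, and outputs $\mathsf{LPO}(p)$. For a linear order $(X,\le_X)$ (with $0$ its least element), $X^\omega$ is the set of finite sequences $\langle (b_0,a_0),\dots,(b_n,a_n)\rangle$ with $b_i\in\mathbb N$, $b_0>\dots>b_n$, $a_i\in X\setminus\{0\}$, ordered lexicographically: proper extensions are larger; otherwise at the first differing position $j$, $\sigma>\tau$ iff $b_j>b'_j$, or $b_j=b'_j$ and $a_j>_Xa'_j$. A sequence $\sigma'$ in $X$ is contained in a sequence $\sigma$ in $X^\omega$ if each $\sigma'_i$ is an entry $a_k$ of some term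 $\sigma_{t_i}$ with $t_i\le t_j$ for $i<j$. $\mathsf{WOP}(X\mapsto X^\omega)$: instance is a linear order $X$ with an infinite decreasing sequence $\sigma$ in $X^\omega$; solutions are infinite decreasing sequences in $X$ contained in $\sigma$. -}

module Defs where

open import Data.Nat using (ℕ; zero; suc; _+_; _≤_; _<_)
open import Data.Fin using (Fin)
open import Data.Vec using (Vec; []; _∷_; lookup)
open import Data.Product using (Σ; _×_; _,_)
open import Data.Sum using (_⊎_)
open import Relation.Binary.PropositionalEquality using (_≡_; _≢_)
open import Relation.Nullary using (¬_)

-- Baire space: all instances and solutions are named by elements of it.

Baire : Set
Baire = ℕ → ℕ

tri : ℕ → ℕ
tri zero    = zero
tri (suc n) = suc n + tri n

pair : ℕ → ℕ → ℕ
pair i s = tri (i + s) + s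

-- X ⊕ Y : (X ⊕ Y)(2n) = X n, (X ⊕ Y)(2n+1) = Y n
_⊕_ : Baire → Baire → Baire
(X ⊕ Y) zero          = X zero
(X ⊕ Y) (suc zero)    = Y zero
(X ⊕ Y) (suc (suc n)) = ((λ m → X (suc m)) ⊕ (λ m → Y (suc m))) n

-- Oracle partial recursive functions (= Turing functionals).

data Code : ℕ → Set where
  zer  : ∀ {k} → Code k
  succ : Code 1
  prj  : ∀ {k} → Fin k → Code k
  orc  : Code 1
  comp : ∀ {k m} → Code m → Vec (Code k) m → Code k
  prec : ∀ {k} → Code k → Code (suc (suc k)) → Code (suc k)
  mu   : ∀ {k} → Code (suc k) → Code k

data Eval (X : Baire) : ∀ {k} → Code k → Vec ℕ k → ℕ → Set
data EvalV (X : Baire) : ∀ {k m} → Vec (Code k) m → Vec ℕ k → Vec ℕ m → Set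

data Eval X where
  ev-zer  : ∀ {k} {xs : Vec ℕ k} → Eval X zer xs 0
  ev-succ : ∀ {x} → Eval X succ (x ∷ []) (suc x)
  ev-prj  : ∀ {k} {xs : Vec ℕ k} (i : Fin k) → Eval X (prj i) xs (lookup xs i)
  ev-orc  : ∀ {x} → Eval X orc (x ∷ []) (X x)
  ev-comp : ∀ {k m} {f : Code m} {gs : Vec (Code k) m} {xs ys y} →
            EvalV X gs xs ys → Eval X f ys y → Eval X (comp f gs) xs y
  ev-prec0 : ∀ {k} {f : Code k} {g} {xs y} →
             Eval X f xs y → Eval X (prec f g) (0 ∷ xs) y
  ev-precS : ∀ {k} {f : Code k} {g} {n xs y z} →
             Eval X (prec f g) (n ∷ xs) y → Eval X g (n ∷ y ∷ xs) z →
             Eval X (prec f g) (suc n ∷ xs) z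
  ev-mu   : ∀ {k} {f : Code (suc k)} {xs y} →
            Eval X f (y ∷ xs) 0 →
            (∀ z → z < y → Σ ℕ (λ w → Eval X f (z ∷ xs) (suc w))) →
            Eval X (mu f) xs y

data EvalV X where
  evv-[] : ∀ {k} {xs : Vec ℕ k} → EvalV X [] xs []
  evv-∷  : ∀ {k m} {g : Code k} {gs : Vec (Code k) m} {xs y ys} →
           Eval X g xs y → EvalV X gs xs ys → EvalV X (g ∷ gs) xs (y ∷ ys)

Computes : Code 1 → Baire → Baire → Set
Computes e X Z = ∀ n → Eval X e (n ∷ []) (Z n)

record Problem : Set₁ where
  field
    Inst : Baire → Set
    Sol  : Baire → Baire → Set
open Problem public

_≤W_ : Problem → Problem → Set
P ≤W Q = Σ (Code 1) λ H → Σ (Code 1) λ K →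
  ∀ X → Inst P X →
    Σ Baire λ Z → Computes H X Z × Inst Q Z ×
      (∀ Ŷ → Sol Q Z Ŷ →
         Σ Baire λ W → Computes K (X ⊕ Ŷ) W × Sol P X W)

-- Finite parallelization: instance Z codes n = Z 0 and X_i(m) = Z (1 + ⟨i,m⟩)
-- for i < n; a solution W codes Y_i(m) = W ⟨i,m⟩.
_* : Problem → Problem
Inst (P *) Z = ∀ i → i < Z 0 → Inst P (λ m → Z (suc (pair i m)))
Sol  (P *) Z W = ∀ i → i < Z 0 →
  Sol P (λ m → Z (suc (pair i m))) (λ m → W (pair i m))

-- output of LPO is coded as Y 0 ∈ {0,1}
LPOSol : Baire → Baire → Set
LPOSol p Y = (Y 0 ≡ 0 × (∀ n → p n ≡ 0)) ⊎ (Y 0 ≡ 1 × Σ ℕ λ n → p n ≢ 0)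

LPO : Problem
Inst LPO p = ∀ n → p n ≤ 1
Sol  LPO p Y = LPOSol p Y

-- Q codes the sequence ⟨p_0,p_1,…⟩ by p_i(s) = Q ⟨i,s⟩
LimIs : Baire → ℕ → ℕ → Set
LimIs Q i v = Σ ℕ λ s₀ → ∀ s → s₀ ≤ s → Q (pair i s) ≡ v

LPO′ : Problem
Inst LPO′ Q = (∀ n → Q n ≤ 1) × (∀ i → Σ ℕ λ v → LimIs Q i v)
Sol  LPO′ Q Y = Σ Baire λ p → (∀ i → LimIs Q i (p i)) × LPOSol p Y

-- WOP(X ↦ X^ω)
-- An instance A codes:
--   field of X:      x ∈ X      iff A ⟨0,x⟩ ≡ 1
--   order of X:      x ≤_X y    iff A ⟨1,⟨x,y⟩⟩ ≡ 1
--   the sequence σ = (σ_k)_k in X^ω, where σ_k = ⟨(b_0,a_0),…,(b_{L-1},a_{L-1})⟩ with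
--     L = A ⟨2,k⟩,  b_j = A ⟨3,⟨k,j⟩⟩,  a_j = A ⟨4,⟨k,j⟩⟩.

module _ (A : Baire) where
  InX : ℕ → Set
  InX x = A (pair 0 x) ≡ 1

  LeX : ℕ → ℕ → Set
  LeX x y = A (pair 1 (pair x y)) ≡ 1

  LtX : ℕ → ℕ → Set
  LtX x y = LeX x y × x ≢ y

  len : ℕ → ℕ
  len k = A (pair 2 k)

  bAt : ℕ → ℕ → ℕ
  bAt k j = A (pair 3 (pair k j))

  aAt : ℕ → ℕ → ℕ
  aAt k j = A (pair 4 (pair k j))

  IsLinOrd0 : Set
  IsLinOrd0 =
    (∀ x → InX x → LeX x x) ×
    (∀ x y → InX x → InX y → LeX x y → LeX y x → x ≡ y) ×
    (∀ x y z → InX x → InX y → InX z → LeX x y → LeX y z → LeX x z) ×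
    (∀ x y → InX x → InX y → LeX x y ⊎ LeX y x) ×
    InX 0 × (∀ x → InX x → LeX 0 x)

  InXω : ℕ → Set
  InXω k =
    (∀ j → suc j < len k → bAt k (suc j) < bAt k j) ×
    (∀ j → j < len k → InX (aAt k j) × aAt k j ≢ 0)

  AgreeAt : ℕ → ℕ → ℕ → Set
  AgreeAt k k′ j = bAt k j ≡ bAt k′ j × aAt k j ≡ aAt k′ j

  LtXω : ℕ → ℕ → Set
  LtXω k′ k =
    (len k′ < len k × (∀ j → j < len k′ → AgreeAt k′ k j)) ⊎
    (Σ ℕ λ j → j < len k′ × j < len k × (∀ i → i < j → AgreeAt k′ k i) ×
       (bAt k′ j < bAt k j ⊎ (bAt k′ j ≡ bAt k j × LtX (aAt k′ j) (aAt k j))))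

  ContainedIn : Baire → Set
  ContainedIn Y = Σ Baire λ t →
    (∀ i j → i < j → t i ≤ t j) ×
    (∀ i → Σ ℕ λ m → m < len (t i) × aAt (t i) m ≡ Y i)

WOPω : Problem
Inst WOPω A = IsLinOrd0 A × (∀ k → InXω A k) × (∀ k → LtXω A (suc k) k)
Sol  WOPω A Y = (∀ i → InX A (Y i)) × (∀ i → LtX A (Y (suc i)) (Y i)) × ContainedIn A Y

-- For q : ℕ → Bool, let X_q be ℕ ordered with 0 least and otherwise as pairs
-- (a , b), by a and then by b reversed, and let σ_k = ω¹·(0 , c) + ω⁰·(c + 1 , k)
-- where c counts the trues among q 0 … q k: a new true lowers the leading term,
-- otherwise the trailing term descends.  If q has exactly N trues, σ contains only
-- finitely many elements below block N + 1, so every solution starts in that block.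
--
-- Given a reduction (H , K), continuity lets H fix the number n of LPO′ instances
-- after a finite prefix of q, so their answers form one of 2ⁿ bit vectors.  Each
-- guess is defeated in turn: either K never outputs on any extension, or it outputs
-- on some finite extension, which we pad with falses so the output persists and then
-- follow by enough trues that the true last block lies beyond it.  The resulting q has
-- finitely many trues and its actual answers are one of the defeated guesses.  The
-- case distinctions are classical; they are made in the double-negation monad, which
-- suffices as the goal is ⊥.

module Submission where

open import Data.Bool using (Bool; true; false; T)
open import Data.Empty using (⊥; ⊥-elim)
open import Data.List using (List; []; _∷_; _++_; length; replicate; map)
open import Data.List.Membership.Propositional using (_∈_)
open import Data.List.Membership.Propositional.Properties using (∈-map⁺; ∈-++⁺ˡ; ∈-++⁺ʳ)
open import Data.List.Properties using (++-assoc; ++-identityʳ)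
open import Data.List.Relation.Unary.All as All using (All; []; _∷_)
open import Data.List.Relation.Unary.Any using (here)
open import Data.Nat
open import Data.Nat.Induction using (<-wellFounded)
open import Data.Nat.Properties
open import Data.Product using (Σ; ∃; ∃₂; _×_; _,_; proj₁; proj₂; uncurry)
open import Data.Product.Relation.Binary.Lex.NonStrict using (×-Lex; ×-isDecTotalOrder)
import Data.Product.Relation.Binary.Lex.Strict as Strict
open import Data.Product.Relation.Binary.Pointwise.NonDependent using (Pointwise; ≡×≡⇒≡; ≡⇒≡×≡)
open import Data.Sum as Sum using (_⊎_; inj₁; inj₂)
open import Data.Vec using (Vec; []; _∷_)
open import Effect.Monad using (RawMonad)
open import Function using (_∘_; _on_; id)
open import Induction.InfiniteDescent using (InfiniteDescendingSequence; Descent; descent∧wf⇒empty)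
open import Induction.WellFounded using (WellFounded)
open import Level using (0ℓ)
import Relation.Binary.Construct.Add.Infimum.NonStrict as Infimum
import Relation.Binary.Construct.Flip.EqAndOrd as Flip
import Relation.Binary.Construct.On as On
open import Relation.Binary.Core using (Rel)
open import Relation.Binary.Definitions using (tri<; tri≈; tri>)
open import Relation.Binary.PropositionalEquality
open import Relation.Binary.Structures using (IsDecTotalOrder)
open import Relation.Nullary using (¬_)
open import Relation.Nullary.Construct.Add.Infimum using (_₋; ⊥₋; [_]; []-injective)
open import Relation.Nullary.Decidable
  using (Dec; yes; no; ⌊_⌋; toWitness; fromWitness; decidable-stable; ¬¬-excluded-middle)
open import Relation.Nullary.Negation using (¬¬-Monad)

open import Defs

next : ℕ × ℕ → ℕ × ℕ
next (zero  , s) = (suc s , 0)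
next (suc i , s) = (i , suc s)

unpair : ℕ → ℕ × ℕ
unpair zero    = (0 , 0)
unpair (suc p) = next (unpair p)

pair-next : ∀ i s → uncurry pair (next (i , s)) ≡ suc (pair i s)
pair-next zero s = begin
  tri (suc s + 0) + 0  ≡⟨ +-identityʳ _ ⟩
  tri (suc s + 0)      ≡⟨ cong tri (+-identityʳ (suc s)) ⟩
  suc (s + tri s)      ≡⟨ cong suc (+-comm s (tri s)) ⟩
  suc (tri s + s)      ∎
  where open ≡-Reasoning
pair-next (suc i) s = begin
  tri (i + suc s) + suc s        ≡⟨ cong (λ d → tri d + suc s) (+-suc i s) ⟩
  tri (suc i + s) + suc s        ≡⟨ +-suc (tri (suc i + s)) s ⟩
  suc (tri (suc i + s) + s)      ∎
  where open ≡-Reasoning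

pair-unpair : ∀ p → uncurry pair (unpair p) ≡ p
pair-unpair zero = refl
pair-unpair (suc p) =
  trans (pair-next (proj₁ (unpair p)) (proj₂ (unpair p))) (cong suc (pair-unpair p))

unpair-pair : ∀ i s → unpair (pair i s) ≡ (i , s)
unpair-pair i s = go (i + s) i s refl
  where
  -- The diagonal d = i + s is explicit only to make the recursion structural.
  go : ∀ d i s → i + s ≡ d → unpair (pair i s) ≡ (i , s)
  go d i (suc s) i+s≡d = trans (cong unpair (pair-next (suc i) s))
    (cong next (go d (suc i) s (trans (sym (+-suc i s)) i+s≡d)))
  go d zero zero _ = refl
  go (suc d) (suc i) zero i+s≡d = trans (cong unpair (pair-next zero i))
    (cong next (go d zero i (suc-injective (trans (sym (+-identityʳ (suc i))) i+s≡d))))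

unpair-injective : ∀ {p p′} → unpair p ≡ unpair p′ → p ≡ p′
unpair-injective {p} {p′} eq = begin
  p                        ≡⟨ pair-unpair p ⟨
  uncurry pair (unpair p)  ≡⟨ cong (uncurry pair) eq ⟩
  uncurry pair (unpair p′) ≡⟨ pair-unpair p′ ⟩
  p′                       ∎
  where open ≡-Reasoning

unpair₁≤ : ∀ p → proj₁ (unpair p) ≤ p
unpair₁≤ p = subst (proj₁ (unpair p) ≤_) (pair-unpair p)
  (≤-trans (m≤m+n _ _) (≤-trans (n≤tri _) (m≤m+n _ _)))
  where
  n≤tri : ∀ n → n ≤ tri n
  n≤tri zero = z≤n
  n≤tri (suc n) = m≤m+n (suc n) (tri n)

unpair₂≤ : ∀ p → proj₂ (unpair p) ≤ p
unpair₂≤ p = subst (proj₂ (unpair p) ≤_) (pair-unpair p) (m≤n+m _ _)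

-- Continuity and determinism of Turing functionals

AgreeBelow : ℕ → Baire → Baire → Set
AgreeBelow B X X′ = ∀ u → u < B → X u ≡ X′ u

Nbhd : (Baire → Set) → Baire → Set
Nbhd P X = Σ ℕ λ B → ∀ X′ → AgreeBelow B X X′ → P X′

nbhd-map : ∀ {P Q : Baire → Set} {X} → (∀ {X′} → P X′ → Q X′) → Nbhd P X → Nbhd Q X
nbhd-map f (B , p) = B , λ X′ agree → f (p X′ agree)

nbhd-zip : ∀ {P Q R : Baire → Set} {X} → (∀ {X′} → P X′ → Q X′ → R X′) →
           Nbhd P X → Nbhd Q X → Nbhd R X
nbhd-zip f (B , p) (C , q) = B + C , λ X′ agree →
  f (p X′ (λ u u<B → agree u (≤-trans u<B (m≤m+n B C))))
    (q X′ (λ u u<C → agree u (≤-trans u<C (m≤n+m C B))))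

nbhd-const : ∀ {P : Baire → Set} {X} → (∀ {X′} → P X′) → Nbhd P X
nbhd-const p = 0 , λ _ _ → p

Searched : ∀ {k} → Baire → Code (suc k) → Vec ℕ k → ℕ → Set
Searched X f xs y = ∀ z → z < y → Σ ℕ λ w → Eval X f (z ∷ xs) (suc w)

eval-nbhd : ∀ {X k} {e : Code k} {xs y} → Eval X e xs y → Nbhd (λ X′ → Eval X′ e xs y) X
evalV-nbhd : ∀ {X k m} {gs : Vec (Code k) m} {xs ys} →
             EvalV X gs xs ys → Nbhd (λ X′ → EvalV X′ gs xs ys) X
searched-nbhd : ∀ {X k} {f : Code (suc k)} {xs} y →
                Searched X f xs y → Nbhd (λ X′ → Searched X′ f xs y) X

eval-nbhd ev-zer = nbhd-const ev-zer
eval-nbhd ev-succ = nbhd-const ev-succ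
eval-nbhd (ev-prj i) = nbhd-const (ev-prj i)
eval-nbhd (ev-orc {x}) =
  suc x , λ X′ agree → subst (Eval X′ orc (x ∷ [])) (sym (agree x ≤-refl)) ev-orc
eval-nbhd (ev-comp ds d) = nbhd-zip ev-comp (evalV-nbhd ds) (eval-nbhd d)
eval-nbhd (ev-prec0 d) = nbhd-map ev-prec0 (eval-nbhd d)
eval-nbhd (ev-precS d d′) = nbhd-zip ev-precS (eval-nbhd d) (eval-nbhd d′)
eval-nbhd (ev-mu {y = y} d below) = nbhd-zip ev-mu (eval-nbhd d) (searched-nbhd y below)

evalV-nbhd evv-[] = nbhd-const evv-[]
evalV-nbhd (evv-∷ d ds) = nbhd-zip evv-∷ (eval-nbhd d) (evalV-nbhd ds)

searched-nbhd zero below = nbhd-const (λ _ ())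
searched-nbhd (suc y) below =
  nbhd-zip extend (searched-nbhd y (λ z z<y → below z (m<n⇒m<1+n z<y)))
                  (eval-nbhd (proj₂ (below y ≤-refl)))
  where
  extend : ∀ {X′} → Searched X′ _ _ y → Eval X′ _ _ _ → Searched X′ _ _ (suc y)
  extend below′ d z z<1+y with m<1+n⇒m<n∨m≡n z<1+y
  ... | inj₁ z<y  = below′ z z<y
  ... | inj₂ refl = _ , d

eval-deterministic : ∀ {X k} {e : Code k} {xs y y′} → Eval X e xs y → Eval X e xs y′ → y ≡ y′
evalV-deterministic : ∀ {X k m} {gs : Vec (Code k) m} {xs ys ys′} →
                      EvalV X gs xs ys → EvalV X gs xs ys′ → ys ≡ ys′

eval-deterministic ev-zer ev-zer = refl
eval-deterministic ev-succ ev-succ = refl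
eval-deterministic (ev-prj i) (ev-prj .i) = refl
eval-deterministic ev-orc ev-orc = refl
eval-deterministic (ev-comp ds d) (ev-comp ds′ d′)
  with refl ← evalV-deterministic ds ds′ = eval-deterministic d d′
eval-deterministic (ev-prec0 d) (ev-prec0 d′) = eval-deterministic d d′
eval-deterministic (ev-precS d e) (ev-precS d′ e′)
  with refl ← eval-deterministic d d′ = eval-deterministic e e′
eval-deterministic (ev-mu {y = y} d below) (ev-mu {y = y′} d′ below′) with <-cmp y y′
... | tri≈ _ y≡y′ _ = y≡y′
... | tri< y<y′ _ _ with () ← eval-deterministic d (proj₂ (below′ y y<y′))
... | tri> _ _ y′<y with () ← eval-deterministic d′ (proj₂ (below y′ y′<y))

evalV-deterministic evv-[] evv-[] = refl
evalV-deterministic (evv-∷ d ds) (evv-∷ d′ ds′) =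
  cong₂ _∷_ (eval-deterministic d d′) (evalV-deterministic ds ds′)

bit : Bool → ℕ
bit true  = 1
bit false = 0

bit≡1⇒T : ∀ {b} → bit b ≡ 1 → T b
bit≡1⇒T {true} _ = _

T⇒bit≡1 : ∀ {b} → T b → bit b ≡ 1
T⇒bit≡1 {true} _ = refl

toSeq : List Bool → ℕ → Bool
toSeq []      _       = false
toSeq (b ∷ s) zero    = b
toSeq (b ∷ s) (suc k) = toSeq s k

trues : List Bool → ℕ
trues []      = 0
trues (b ∷ s) = bit b + trues s

trues-++ : ∀ s t → trues (s ++ t) ≡ trues s + trues t
trues-++ []      t = refl
trues-++ (b ∷ s) t = trans (cong (bit b +_) (trues-++ s t)) (sym (+-assoc (bit b) _ _))

trues-replicate : ∀ n → trues (replicate n true) ≡ n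
trues-replicate zero    = refl
trues-replicate (suc n) = cong suc (trues-replicate n)

infix 4 _≼_

_≼_ : {A : Set} → List A → List A → Set
s ≼ s′ = ∃ λ u → s′ ≡ s ++ u

≼-refl : {A : Set} {s : List A} → s ≼ s
≼-refl {s = s} = [] , sym (++-identityʳ s)

≼-trans : {A : Set} {s s′ s″ : List A} → s ≼ s′ → s′ ≼ s″ → s ≼ s″
≼-trans {s = s} (u , refl) (u′ , refl) = u ++ u′ , ++-assoc s u u′

≼-++ : {A : Set} (s u : List A) → s ≼ s ++ u
≼-++ s u = u , refl

toSeq-padded : ∀ s B {s′} → s ++ replicate B false ≼ s′ →
               ∀ k → k < length s + B → toSeq s′ k ≡ toSeq s k
toSeq-padded s B (u , refl) = go s B
  where
  go : ∀ s B k → k < length s + B → toSeq ((s ++ replicate B false) ++ u) k ≡ toSeq s k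
  go []      (suc B) zero    _          = refl
  go []      (suc B) (suc k) (s<s k<B)  = go [] B k k<B
  go (b ∷ s) B       zero    _          = refl
  go (b ∷ s) B       (suc k) (s<s k<ℓ)  = go s B k k<ℓ

cnt : (ℕ → Bool) → ℕ → ℕ
cnt q zero    = bit (q 0)
cnt q (suc k) = bit (q 0) + cnt (q ∘ suc) k

cnt-suc : ∀ q k → cnt q (suc k) ≡ cnt q k + bit (q (suc k))
cnt-suc q zero    = refl
cnt-suc q (suc k) =
  trans (cong (bit (q 0) +_) (cnt-suc (q ∘ suc) k)) (sym (+-assoc (bit (q 0)) _ _))

cnt-cong : ∀ {q q′} k → (∀ i → i ≤ k → q i ≡ q′ i) → cnt q k ≡ cnt q′ k
cnt-cong zero    eq = cong bit (eq 0 z≤n)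
cnt-cong (suc k) eq = cong₂ _+_ (cong bit (eq 0 z≤n)) (cnt-cong k (λ i i≤k → eq (suc i) (s≤s i≤k)))

cnt-toSeq-≤ : ∀ s k → cnt (toSeq s) k ≤ trues s
cnt-toSeq-≤ []      zero    = z≤n
cnt-toSeq-≤ []      (suc k) = cnt-toSeq-≤ [] k
cnt-toSeq-≤ (b ∷ s) zero    = m≤m+n (bit b) (trues s)
cnt-toSeq-≤ (b ∷ s) (suc k) = +-monoʳ-≤ (bit b) (cnt-toSeq-≤ s k)

cnt-toSeq-beyond : ∀ s k → length s ≤ k → cnt (toSeq s) k ≡ trues s
cnt-toSeq-beyond []      k       _           = n≤0⇒n≡0 (cnt-toSeq-≤ [] k)
cnt-toSeq-beyond (b ∷ s) (suc k) (s≤s ℓ≤k) = cong (bit b +_) (cnt-toSeq-beyond s k ℓ≤k)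

≤-trues-++-replicate : ∀ s F → F ≤ trues (s ++ replicate F true)
≤-trues-++-replicate s F = begin
  F                                   ≤⟨ m≤n+m F (trues s) ⟩
  trues s + F                         ≡⟨ cong (trues s +_) (trues-replicate F) ⟨
  trues s + trues (replicate F true)  ≡⟨ trues-++ s _ ⟨
  trues (s ++ replicate F true)       ∎
  where open ≤-Reasoning

Causal : ((ℕ → Bool) → Baire) → Set
Causal Φ = ∀ {q q′} p → (∀ k → k ≤ p → q k ≡ q′ k) → Φ q p ≡ Φ q′ p

⊕-congˡ : ∀ {X X′} Y u → (∀ p → p ≤ u → X p ≡ X′ p) → (X ⊕ Y) u ≡ (X′ ⊕ Y) u
⊕-congˡ Y zero          agree = agree 0 z≤n
⊕-congˡ Y (suc zero)    agree = refl
⊕-congˡ Y (suc (suc u)) agree =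
  ⊕-congˡ (Y ∘ suc) u (λ p p≤u → agree (suc p) (s≤s (m≤n⇒m≤1+n p≤u)))

⊕-causal : ∀ {Φ} → Causal Φ → ∀ Y → Causal (λ q → Φ q ⊕ Y)
⊕-causal causal Y u agree = ⊕-congˡ Y u (λ p p≤u → causal p (λ k k≤p → agree k (≤-trans k≤p p≤u)))

eval-persists : ∀ {Φ} → Causal Φ → ∀ s {k} {e : Code k} {xs y} → Eval (Φ (toSeq s)) e xs y →
                Σ ℕ λ B → ∀ {s′} → s ++ replicate B false ≼ s′ → Eval (Φ (toSeq s′)) e xs y
eval-persists {Φ} causal s ev with eval-nbhd ev
... | B , near = B , λ {s′} s+pad≼s′ → near (Φ (toSeq s′)) λ u u<B →
  causal u (λ k k≤u →
    sym (toSeq-padded s B s+pad≼s′ k (≤-<-trans k≤u (<-≤-trans u<B (m≤n+m B (length s))))))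

_≤ₗ_ : Rel (ℕ × ℕ) 0ℓ
_≤ₗ_ = ×-Lex _≡_ _≤_ _≥_

≤ₗ-isDecTotalOrder : IsDecTotalOrder (Pointwise _≡_ _≡_) _≤ₗ_
≤ₗ-isDecTotalOrder = ×-isDecTotalOrder ≤-isDecTotalOrder (Flip.isDecTotalOrder ≤-isDecTotalOrder)

private module ≤ₗ = IsDecTotalOrder ≤ₗ-isDecTotalOrder
open Infimum _≤ₗ_
  using (_≤₋_; ⊥₋≤_; [_]; [≤]-injective; ≤₋-trans; ≤₋-total; ≤₋-dec; ≤₋-reflexive-≡; ≤₋-antisym-≡)

point : ℕ → (ℕ × ℕ) ₋
point zero    = ⊥₋
point (suc x) = [ unpair x ]

point-injective : ∀ {x y} → point x ≡ point y → x ≡ y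
point-injective {zero}  {zero}  _  = refl
point-injective {suc x} {suc y} eq = cong suc (unpair-injective ([]-injective eq))

infix 4 _⊑_

_⊑_ : ℕ → ℕ → Set
x ⊑ y = point x ≤₋ point y

⊑-refl : ∀ x → x ⊑ x
⊑-refl x = ≤₋-reflexive-≡ (≤ₗ.reflexive ∘ ≡⇒≡×≡) refl

⊑-antisym : ∀ {x y} → x ⊑ y → y ⊑ x → x ≡ y
⊑-antisym x⊑y y⊑x = point-injective (≤₋-antisym-≡ (λ p q → ≡×≡⇒≡ (≤ₗ.antisym p q)) x⊑y y⊑x)

⊑-trans : ∀ {x y z} → x ⊑ y → y ⊑ z → x ⊑ z
⊑-trans = ≤₋-trans ≤ₗ.trans

⊑-total : ∀ x y → x ⊑ y ⊎ y ⊑ x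
⊑-total x y = ≤₋-total ≤ₗ.total (point x) (point y)

_⊑?_ : ∀ x y → Dec (x ⊑ y)
x ⊑? y = ≤₋-dec ≤ₗ._≤?_ (point x) (point y)

0⊑ : ∀ x → 0 ⊑ x
0⊑ x = ⊥₋≤ point x

enc : ℕ × ℕ → ℕ
enc (a , b) = suc (pair a b)

point-enc : ∀ r → point (enc r) ≡ [ r ]
point-enc (a , b) = cong [_] (unpair-pair a b)

enc-injective : ∀ {r r′} → enc r ≡ enc r′ → r ≡ r′
enc-injective {r} {r′} eq = []-injective (begin
  [ r ]          ≡⟨ point-enc r ⟨
  point (enc r)  ≡⟨ cong point eq ⟩
  point (enc r′) ≡⟨ point-enc r′ ⟩
  [ r′ ]         ∎)
  where open ≡-Reasoning

enc-⊑ : ∀ {r r′} → r ≤ₗ r′ → enc r ⊑ enc r′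
enc-⊑ {r} {r′} r≤r′ = subst₂ _≤₋_ (sym (point-enc r)) (sym (point-enc r′)) [ r≤r′ ]

⊑-enc : ∀ {r r′} → enc r ⊑ enc r′ → r ≤ₗ r′
⊑-enc {r} {r′} le = [≤]-injective (subst₂ _≤₋_ (point-enc r) (point-enc r′) le)

BoundedLex : ℕ → Rel (ℕ × ℕ) 0ℓ
BoundedLex M = Strict.×-Lex _≡_ _<_ (_<_ on (M ∸_))

boundedLex-wellFounded : ∀ M → WellFounded (BoundedLex M)
boundedLex-wellFounded M = Strict.×-wellFounded <-wellFounded (On.wellFounded (M ∸_) <-wellFounded)

<ₗ⇒boundedLex : ∀ M {r r′} → r′ ≤ₗ r → r′ ≢ r → proj₂ r′ ≤ M → BoundedLex M r′ r
<ₗ⇒boundedLex M (inj₁ (a′≤a , a′≢a)) _    _   = inj₁ (≤∧≢⇒< a′≤a a′≢a)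
<ₗ⇒boundedLex M (inj₂ (refl , b≤b′)) r′≢r b′≤M =
  inj₂ (refl , ∸-monoʳ-< (≤∧≢⇒< b≤b′ (λ b≡b′ → r′≢r (cong (_ ,_) (sym b≡b′)))) b′≤M)

wellFounded⇒¬descending : {A : Set} {_<_ : Rel A 0ℓ} → WellFounded _<_ →
                          (f : ℕ → A) → ¬ InfiniteDescendingSequence _<_ f
wellFounded⇒¬descending {_<_ = _<_} wf f descending =
  descent∧wf⇒empty step wf (f 0) (0 , refl)
  where
  step : Descent _<_ (λ x → ∃ λ i → f i ≡ x)
  step (i , refl) = f (suc i) , descending i , suc i , refl

-- The instance X_q

exponent : ℕ → ℕ
exponent zero    = 1
exponent (suc _) = 0

entry : (ℕ → Bool) → ℕ → ℕ → ℕ × ℕ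
entry q k zero    = (0 , cnt q k)
entry q k (suc _) = (suc (cnt q k) , k)

table : (ℕ → Bool) → ℕ → ℕ → ℕ
table q 0 _ = 1
table q 1 r = bit ⌊ proj₁ (unpair r) ⊑? proj₂ (unpair r) ⌋
table q 2 _ = 2
table q 3 r = exponent (proj₂ (unpair r))
table q 4 r = enc (uncurry (entry q) (unpair r))
table q _ _ = 0

wop : (ℕ → Bool) → Baire
wop q p = uncurry (table q) (unpair p)

module _ (q : ℕ → Bool) where

  wop-pair : ∀ c r → wop q (pair c r) ≡ table q c r
  wop-pair c r = cong (uncurry (table q)) (unpair-pair c r)

  wop-field : ∀ x → InX (wop q) x
  wop-field = wop-pair 0

  wop-le : ∀ x y → wop q (pair 1 (pair x y)) ≡ bit ⌊ x ⊑? y ⌋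
  wop-le x y = trans (wop-pair 1 (pair x y)) (cong (λ (u , v) → bit ⌊ u ⊑? v ⌋) (unpair-pair x y))

  LeX⇒⊑ : ∀ x y → LeX (wop q) x y → x ⊑ y
  LeX⇒⊑ x y le = toWitness (bit≡1⇒T (trans (sym (wop-le x y)) le))

  ⊑⇒LeX : ∀ x y → x ⊑ y → LeX (wop q) x y
  ⊑⇒LeX x y x⊑y = trans (wop-le x y) (T⇒bit≡1 (fromWitness x⊑y))

  wop-len : ∀ k → len (wop q) k ≡ 2
  wop-len = wop-pair 2

  wop-b : ∀ k j → bAt (wop q) k j ≡ exponent j
  wop-b k j = trans (wop-pair 3 (pair k j)) (cong (exponent ∘ proj₂) (unpair-pair k j))

  wop-a : ∀ k j → aAt (wop q) k j ≡ enc (entry q k j)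
  wop-a k j = trans (wop-pair 4 (pair k j)) (cong (enc ∘ uncurry (entry q)) (unpair-pair k j))

  wop-linearOrder : IsLinOrd0 (wop q)
  wop-linearOrder =
    (λ x _ → ⊑⇒LeX x x (⊑-refl x)) ,
    (λ x y _ _ x≤y y≤x → ⊑-antisym (LeX⇒⊑ x y x≤y) (LeX⇒⊑ y x y≤x)) ,
    (λ x y z _ _ _ x≤y y≤z → ⊑⇒LeX x z (⊑-trans (LeX⇒⊑ x y x≤y) (LeX⇒⊑ y z y≤z))) ,
    (λ x y _ _ → Sum.map (⊑⇒LeX x y) (⊑⇒LeX y x) (⊑-total x y)) ,
    wop-field 0 ,
    (λ x _ → ⊑⇒LeX 0 x (0⊑ x))

  wop-Xω : ∀ k → InXω (wop q) k
  wop-Xω k = exponents-decrease , entries-in-X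
    where
    exponents-decrease : ∀ j → suc j < len (wop q) k → bAt (wop q) k (suc j) < bAt (wop q) k j
    exponents-decrease j 1+j<len with subst (suc j <_) (wop-len k) 1+j<len
    ... | s<s z<s = subst₂ _<_ (sym (wop-b k 1)) (sym (wop-b k 0)) z<s
    entries-in-X : ∀ j → j < len (wop q) k → InX (wop q) (aAt (wop q) k j) × aAt (wop q) k j ≢ 0
    entries-in-X j _ = wop-field (aAt (wop q) k j) , λ a≡0 → 1+n≢0 (trans (sym (wop-a k j)) a≡0)

  enc-⊏ : ∀ {r r′} → r ≤ₗ r′ → r ≢ r′ → LtX (wop q) (enc r) (enc r′)
  enc-⊏ {r} {r′} r≤r′ r≢r′ = ⊑⇒LeX (enc r) (enc r′) (enc-⊑ r≤r′) , r≢r′ ∘ enc-injective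

  descends-at : ∀ k j → j < 2 → (∀ i → i < j → entry q (suc k) i ≡ entry q k i) →
                entry q (suc k) j ≤ₗ entry q k j → entry q (suc k) j ≢ entry q k j →
                LtXω (wop q) (suc k) k
  descends-at k j j<2 agree le ne = inj₂ (j , j<len (suc k) , j<len k , agreeAt , inj₂ (b≡b , a<a))
    where
    j<len : ∀ k′ → j < len (wop q) k′
    j<len k′ = subst (j <_) (sym (wop-len k′)) j<2
    agreeAt : ∀ i → i < j → AgreeAt (wop q) (suc k) k i
    agreeAt i i<j = trans (wop-b (suc k) i) (sym (wop-b k i)) ,
                    trans (wop-a (suc k) i) (trans (cong enc (agree i i<j)) (sym (wop-a k i)))
    b≡b : bAt (wop q) (suc k) j ≡ bAt (wop q) k j
    b≡b = trans (wop-b (suc k) j) (sym (wop-b k j))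
    a<a : LtX (wop q) (aAt (wop q) (suc k) j) (aAt (wop q) k j)
    a<a = subst₂ (LtX (wop q)) (sym (wop-a (suc k) j)) (sym (wop-a k j)) (enc-⊏ le ne)

  wop-descending : ∀ k → LtXω (wop q) (suc k) k
  wop-descending k with q (suc k) | cnt-suc q k
  ... | true | c′≡c+1 =
    descends-at k 0 z<s (λ _ ()) (inj₂ (refl , <⇒≤ c<c′)) (>⇒≢ c<c′ ∘ cong proj₂)
    where
    c<c′ : cnt q k < cnt q (suc k)
    c<c′ = subst (cnt q k <_) (sym c′≡c+1) (m<m+n _ z<s)
  ... | false | c′≡c+0 =
    descends-at k 1 (s<s z<s) (λ { zero _ → cong (0 ,_) c′≡c ; (suc _) (s<s ()) })
                (inj₂ (cong suc c′≡c , n≤1+n k)) (1+n≢n ∘ cong proj₂)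
    where
    c′≡c : cnt q (suc k) ≡ cnt q k
    c′≡c = trans c′≡c+0 (+-identityʳ _)

  wop-instance : Inst WOPω (wop q)
  wop-instance = wop-linearOrder , wop-Xω , wop-descending

entry-cong : ∀ {q q′} k j → (∀ i → i ≤ k → q i ≡ q′ i) → entry q k j ≡ entry q′ k j
entry-cong k zero    agree = cong (0 ,_) (cnt-cong k agree)
entry-cong k (suc _) agree = cong (λ c → suc c , k) (cnt-cong k agree)

wop-causal : Causal wop
wop-causal {q} {q′} p agree =
  table-cong (proj₁ (unpair p)) (proj₂ (unpair p)) (λ k k≤r → agree k (≤-trans k≤r (unpair₂≤ p)))
  where
  table-cong : ∀ c r → (∀ k → k ≤ r → q k ≡ q′ k) → table q c r ≡ table q′ c r
  table-cong 0 r _ = refl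
  table-cong 1 r _ = refl
  table-cong 2 r _ = refl
  table-cong 3 r _ = refl
  table-cong 4 r agree′ = cong enc (entry-cong (proj₁ (unpair r)) (proj₂ (unpair r))
    (λ k k≤r₁ → agree′ k (≤-trans k≤r₁ (unpair₁≤ r))))
  table-cong (suc (suc (suc (suc (suc _))))) r _ = refl

block : ℕ → ℕ
block x = proj₁ (unpair (pred x))

block-enc : ∀ r → block (enc r) ≡ proj₁ r
block-enc (a , b) = cong proj₁ (unpair-pair a b)

≤ₗ⇒proj₁-≤ : ∀ {r′ r} → r′ ≤ₗ r → proj₁ r′ ≤ proj₁ r
≤ₗ⇒proj₁-≤ (inj₁ (a′≤a , _)) = a′≤a
≤ₗ⇒proj₁-≤ (inj₂ (a′≡a , _)) = ≤-reflexive a′≡a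

entry-block-≤ : ∀ s k j → proj₁ (entry (toSeq s) k j) ≤ suc (trues s)
entry-block-≤ s k zero    = z≤n
entry-block-≤ s k (suc _) = s≤s (cnt-toSeq-≤ s k)

entry-bounded : ∀ s k j → proj₁ (entry (toSeq s) k j) ≤ trues s →
                proj₂ (entry (toSeq s) k j) ≤ trues s + length s
entry-bounded s k zero    _ = ≤-trans (cnt-toSeq-≤ s k) (m≤m+n _ _)
entry-bounded s k (suc _) 1+c≤N with length s ≤? k
... | yes ℓ≤k = ⊥-elim (<-irrefl (cnt-toSeq-beyond s k ℓ≤k) 1+c≤N)
... | no  ℓ≰k = ≤-trans (<⇒≤ (≰⇒> ℓ≰k)) (m≤n+m _ _)

first-in-last-block : ∀ s Y → Sol WOPω (wop (toSeq s)) Y → block (Y 0) ≡ suc (trues s)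
first-in-last-block s Y (_ , descending , t , _ , inσ) =
  decidable-stable (block (Y 0) ≟ suc N) not-earlier
  where
  q : ℕ → Bool
  q = toSeq s
  N : ℕ
  N = trues s
  r : ℕ → ℕ × ℕ
  r i = entry q (t i) (proj₁ (inσ i))
  Y≡enc : ∀ i → Y i ≡ enc (r i)
  Y≡enc i = trans (sym (proj₂ (proj₂ (inσ i)))) (wop-a q (t i) (proj₁ (inσ i)))
  r-≤ : ∀ i → r (suc i) ≤ₗ r i
  r-≤ i = ⊑-enc (subst₂ _⊑_ (Y≡enc (suc i)) (Y≡enc i)
                  (LeX⇒⊑ q (Y (suc i)) (Y i) (proj₁ (descending i))))
  r-≢ : ∀ i → r (suc i) ≢ r i
  r-≢ i eq = proj₂ (descending i) (trans (Y≡enc (suc i)) (trans (cong enc eq) (sym (Y≡enc i))))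
  not-earlier : ¬ block (Y 0) ≢ suc N
  not-earlier earlier = wellFounded⇒¬descending (boundedLex-wellFounded (N + length s)) r
    (λ i → <ₗ⇒boundedLex _ (r-≤ i) (r-≢ i) (second-bounded (suc i)))
    where
    first-bounded : ∀ i → proj₁ (r i) ≤ N
    first-bounded zero = ≤-pred (≤∧≢⇒< (entry-block-≤ s (t 0) (proj₁ (inσ 0)))
                                        (earlier ∘ trans (cong block (Y≡enc 0)) ∘ trans (block-enc (r 0))))
    first-bounded (suc i) = ≤-trans (≤ₗ⇒proj₁-≤ (r-≤ i)) (first-bounded i)
    second-bounded : ∀ i → proj₂ (r i) ≤ N + length s
    second-bounded i = entry-bounded s (t i) (proj₁ (inσ i)) (first-bounded i)

open RawMonad (¬¬-Monad {0ℓ})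

LPOSol-cong : ∀ p Y Y′ → Y 0 ≡ Y′ 0 → LPOSol p Y → LPOSol p Y′
LPOSol-cong p Y Y′ Y0≡ (inj₁ (Y0≡0 , zeros))   = inj₁ (trans (sym Y0≡) Y0≡0 , zeros)
LPOSol-cong p Y Y′ Y0≡ (inj₂ (Y0≡1 , nonzero)) = inj₂ (trans (sym Y0≡) Y0≡1 , nonzero)

¬¬-LPO′-answer : ∀ Q → Inst LPO′ Q → ¬ ¬ Σ Bool λ b → Sol LPO′ Q (λ _ → bit b)
¬¬-LPO′-answer Q (_ , limits) = answer <$> ¬¬-excluded-middle
  where
  p : ℕ → ℕ
  p i = proj₁ (limits i)
  answer : Dec (∃ λ i → p i ≢ 0) → Σ Bool λ b → Sol LPO′ Q (λ _ → bit b)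
  answer (yes nonzero) = true  , p , proj₂ ∘ limits , inj₂ (refl , nonzero)
  answer (no  allzero) = false , p , proj₂ ∘ limits ,
    inj₁ (refl , λ i → decidable-stable (p i ≟ 0) (λ p≢0 → allzero (i , p≢0)))

¬¬-choice : ∀ n {P : ℕ → Bool → Set} → (∀ i → i < n → ¬ ¬ Σ Bool (P i)) →
            ¬ ¬ Σ (List Bool) λ v → length v ≡ n × ∀ i → i < n → P i (toSeq v i)
¬¬-choice zero    _       = pure ([] , refl , λ _ ())
¬¬-choice (suc n) choices = do
  (b , Pb) ← choices 0 z<s
  (v , ∣v∣≡n , Pv) ← ¬¬-choice n (λ i i<n → choices (suc i) (s<s i<n))
  pure (b ∷ v , cong suc ∣v∣≡n , λ { zero _ → Pb ; (suc i) (s<s i<n) → Pv i i<n })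

allBits : ℕ → List (List Bool)
allBits zero    = [] ∷ []
allBits (suc n) = map (true ∷_) (allBits n) ++ map (false ∷_) (allBits n)

∈-allBits : ∀ v → v ∈ allBits (length v)
∈-allBits []          = here refl
∈-allBits (true ∷ v)  = ∈-++⁺ˡ (∈-map⁺ (true ∷_) (∈-allBits v))
∈-allBits (false ∷ v) =
  ∈-++⁺ʳ (map (true ∷_) (allBits (length v))) (∈-map⁺ (false ∷_) (∈-allBits v))

guessSol : List Bool → Baire
guessSol v x = bit (toSeq v (proj₁ (unpair x)))

guessSol-solves : ∀ Z v →
  (∀ i → i < Z 0 → Sol LPO′ (λ m → Z (suc (pair i m))) (λ _ → bit (toSeq v i))) →
  Sol (LPO′ *) Z (guessSol v)
guessSol-solves Z v answers i i<Z0 with answers i i<Z0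
... | p , limits , solves =
  p , limits , LPOSol-cong p (λ _ → bit (toSeq v i)) (λ m → guessSol v (pair i m)) answer≡ solves
  where
  answer≡ : bit (toSeq v i) ≡ guessSol v (pair i 0)
  answer≡ = cong (bit ∘ toSeq v ∘ proj₁) (sym (unpair-pair i 0))

-- The diagonal argument

module Refutation (H K : Code 1)
  (reduce : ∀ X → Inst WOPω X →
    Σ Baire λ Z → Computes H X Z × Inst (LPO′ *) Z ×
      (∀ Ŷ → Sol (LPO′ *) Z Ŷ → Σ Baire λ W → Computes K (X ⊕ Ŷ) W × Sol WOPω X W)) where

  𝕏 : List Bool → Baire
  𝕏 s = wop (toSeq s)

  Out : List Bool → List Bool → ℕ → Set
  Out g s x = Eval (𝕏 s ⊕ guessSol g) K (0 ∷ []) x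

  Avoids : List Bool → List Bool → Set
  Avoids g s = ∀ x → Out g s x → block x ≢ suc (trues s)

  Avoidable : List (List Bool) → List Bool → Set
  Avoidable gs s = Σ (List Bool) λ s₁ → s ≼ s₁ × Σ ℕ λ F →
    ∀ {s₂} → s₁ ≼ s₂ → F ≤ trues s₂ → All (λ g → Avoids g s₂) gs

  avoidable-silent : ∀ {g gs s} → ¬ (∃₂ λ s′ x → s ≼ s′ × Out g s′ x) →
                     Avoidable gs s → Avoidable (g ∷ gs) s
  avoidable-silent silent (s₁ , s≼s₁ , F , avoid) = s₁ , s≼s₁ , F , λ s₁≼s₂ F≤ →
    (λ x out _ → silent (_ , x , ≼-trans s≼s₁ s₁≼s₂ , out)) ∷ avoid s₁≼s₂ F≤

  avoidable-answered : ∀ {g gs s t x} → s ≼ t → (∀ {s′} → t ≼ s′ → Out g s′ x) →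
                       Avoidable gs t → Avoidable (g ∷ gs) s
  avoidable-answered {g} {x = x} s≼t persists (s₁ , t≼s₁ , F , avoid) =
    s₁ , ≼-trans s≼t t≼s₁ , F + block x , λ s₁≼s₂ F+b≤ →
      wrong-block s₁≼s₂ F+b≤ ∷ avoid s₁≼s₂ (≤-trans (m≤m+n F (block x)) F+b≤)
    where
    wrong-block : ∀ {s₂} → s₁ ≼ s₂ → F + block x ≤ trues s₂ → Avoids g s₂
    wrong-block {s₂} s₁≼s₂ F+b≤ y out b≡ =
      1+n≰n (subst (_≤ trues s₂) (trans (cong block x≡y) b≡) b≤)
      where
      x≡y : x ≡ y
      x≡y = eval-deterministic (persists (≼-trans t≼s₁ s₁≼s₂)) out
      b≤ : block x ≤ trues s₂
      b≤ = ≤-trans (m≤n+m (block x) F) F+b≤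

  ¬¬-avoidable : ∀ gs s → ¬ ¬ Avoidable gs s
  ¬¬-avoidable []       s = pure (s , ≼-refl , 0 , λ {_} _ _ → [])
  ¬¬-avoidable (g ∷ gs) s = ¬¬-excluded-middle >>= λ where
    (no silent) → avoidable-silent silent <$> ¬¬-avoidable gs s
    (yes (s′ , x , s≼s′ , out)) →
      let (B , persists) = eval-persists (⊕-causal wop-causal (guessSol g)) s′ out
      in  avoidable-answered (≼-trans s≼s′ (≼-++ s′ _)) persists
            <$> ¬¬-avoidable gs (s′ ++ replicate B false)

  forward-settles : Σ ℕ λ n → Σ (List Bool) λ s₀ → ∀ {s} → s₀ ≼ s → Eval (𝕏 s) H (0 ∷ []) n
  forward-settles with reduce (𝕏 []) (wop-instance _)
  ... | Z , computesZ , _ = Z 0 , _ , proj₂ (eval-persists wop-causal [] (computesZ 0))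

  refuted : ¬ ¬ ⊥
  refuted = do
    let (n , s₀ , H-settled) = forward-settles
    (s₁ , s₀≼s₁ , F , avoid) ← ¬¬-avoidable (allBits n) s₀
    let s = s₁ ++ replicate F true
        (Z , computesZ , instZ , backward) = reduce (𝕏 s) (wop-instance _)
        Z0≡n = eval-deterministic (computesZ 0) (H-settled (≼-trans s₀≼s₁ (≼-++ s₁ _)))
    (v , ∣v∣≡n , answers) ←
      ¬¬-choice n (λ i i<n → ¬¬-LPO′-answer _ (instZ i (subst (i <_) (sym Z0≡n) i<n)))
    let (W , computesW , solves) = backward (guessSol v)
          (guessSol-solves Z v (λ i i<Z0 → answers i (subst (i <_) Z0≡n i<Z0)))
        v∈allBits = subst (λ m → v ∈ allBits m) ∣v∣≡n (∈-allBits v)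
        v-avoided = All.lookup (avoid (≼-++ s₁ _) (≤-trues-++-replicate s₁ F)) v∈allBits
    pure (v-avoided (W 0) (computesW 0) (first-in-last-block s W solves))

mainTheorem12 : ¬ (WOPω ≤W (LPO′ *))
mainTheorem12 (H , K , reduce) = Refutation.refuted H K reduce id
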